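{- Let $n\ge1$, let $T$ be the $n\times n$ cyclic shift matrix and $A=3I_n-T-T^{ -1}$. Then $Jac(Y(n;1,1,1))$ is isomorphic to the torsion subgroup of the abelian group $\operatorname{coker}(3(A^2-A))\oplus\operatorname{coker}(A)$.
   Context: $T=\mathrm{circ}(0,1,0,\ldots,0)$ is the $n\times n$ permutation matrix with $T_{i,i+1}=1$ (indices mod $n$). For an integer $N\times N$ matrix $X$, $\operatorname{coker}(X)=\mathbb{Z}^N/X\mathbb{Z}^N$. The graph $Y(n;1,1,1)$ has vertices $v_{x,y}$, $x\in\{0,1,2,3\}$, $y\in\mathbb{Z}_n$, and edges $v_{i,y}v_{i,y+1}$ and $v_{i,y}v_{0,y}$ for $i=1,2,3$; its Laplacian, with vertices ordered by $x$, is the $4n\times4n$ block matrix $$L=\begin{pmatrix}3I_n&-I_n&-I_n&-I_n\\-I_n&A&0&0\\-I_n&0&A&0\\-I_n&0&0&A\end{pmatrix},$$ and $Jac(Y(n;1,1,1))$ is defined as the torsion subgroup of $\operatorname{coker}(L)$. -}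

module Defs where

open import Data.Nat as ℕ using (ℕ; zero; suc)
open import Data.Nat.DivMod using (_%_)
open import Data.Integer as ℤ using (ℤ; +_; 0ℤ; 1ℤ; -_)
open import Data.Fin as Fin using (Fin; toℕ; remQuot)
open import Data.Product using (Σ; ∃; _×_; _,_; proj₁; proj₂)
open import Data.Bool using (if_then_else_)
open import Relation.Nullary.Decidable using (⌊_⌋)
open import Relation.Binary.PropositionalEquality using (_≡_)
open import Level using (0ℓ)

ZVec : ℕ → Set
ZVec N = Fin N → ℤ

Mat : ℕ → Set
Mat N = Fin N → Fin N → ℤ

∑ : ∀ {N} → (Fin N → ℤ) → ℤ
∑ {zero}  f = 0ℤ
∑ {suc N} f = f Fin.zero ℤ.+ ∑ (λ j → f (Fin.suc j))

_·ᵥ_ : ∀ {N} → Mat N → ZVec N → ZVec N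
(X ·ᵥ v) i = ∑ (λ j → X i j ℤ.* v j)

_*ₘ_ : ∀ {N} → Mat N → Mat N → Mat N
(X *ₘ Y) i k = ∑ (λ j → X i j ℤ.* Y j k)

_+ₘ_ : ∀ {N} → Mat N → Mat N → Mat N
(X +ₘ Y) i j = X i j ℤ.+ Y i j

_-ₘ_ : ∀ {N} → Mat N → Mat N → Mat N
(X -ₘ Y) i j = X i j ℤ.- Y i j

_·ₘ_ : ∀ {N} → ℤ → Mat N → Mat N
(c ·ₘ X) i j = c ℤ.* X i j

Iₘ : ∀ {N} → Mat N
Iₘ i j = if ⌊ i Fin.≟ j ⌋ then 1ℤ else 0ℤ

0ₘ : ∀ {N} → Mat N
0ₘ i j = 0ℤ

transpose : ∀ {N} → Mat N → Mat N
transpose X i j = X j i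

shiftT : (m : ℕ) → Mat (suc m)
shiftT m i j = if ⌊ toℕ j ℕ.≟ (suc (toℕ i)) % (suc m) ⌋ then 1ℤ else 0ℤ

-- T⁻¹ = Tᵀ (T is a permutation matrix)
-- A = 3 I - T - T⁻¹
matA : (m : ℕ) → Mat (suc m)
matA m = (((+ 3) ·ₘ Iₘ) -ₘ shiftT m) -ₘ transpose (shiftT m)

-- Laplacian of Y(n;1,1,1), 4n × 4n, vertices ordered by x
-- (index combine x y = x * n + y; remQuot recovers (x , y)).
block4 : ∀ {n} → (Fin 4 → Fin 4 → Mat n) → Mat (4 ℕ.* n)
block4 {n} B p q with remQuot {4} n p | remQuot {4} n q
... | (x , y) | (x' , y') = B x x' y y'

lapBlocks : (m : ℕ) → Fin 4 → Fin 4 → Mat (suc m)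
lapBlocks m Fin.zero Fin.zero = (+ 3) ·ₘ Iₘ
lapBlocks m Fin.zero (Fin.suc _) = (- 1ℤ) ·ₘ Iₘ
lapBlocks m (Fin.suc _) Fin.zero = (- 1ℤ) ·ₘ Iₘ
lapBlocks m (Fin.suc i) (Fin.suc j) =
  if ⌊ i Fin.≟ j ⌋ then matA m else 0ₘ

lapY : (m : ℕ) → Mat (4 ℕ.* suc m)
lapY m = block4 (lapBlocks m)

-- Abelian groups given concretely by a carrier, an equivalence
-- (the group equality), addition and zero.  Used for cokernels
-- (quotients presented as setoids) and their direct sums.

record PGroup : Set₁ where
  field
    Carrier : Set
    _≈_     : Carrier → Carrier → Set
    _+_     : Carrier → Carrier → Carrier
    zeroG   : Carrier

coker : ∀ {N} → Mat N → PGroup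
coker {N} X = record
  { Carrier = ZVec N
  ; _≈_     = λ v w → ∃ λ (u : ZVec N) → ∀ i → v i ℤ.- w i ≡ (X ·ᵥ u) i
  ; _+_     = λ v w i → v i ℤ.+ w i
  ; zeroG   = λ _ → 0ℤ
  }

_⊕_ : PGroup → PGroup → PGroup
G ⊕ H = record
  { Carrier = G.Carrier × H.Carrier
  ; _≈_     = λ a b → (proj₁ a G.≈ proj₁ b) × (proj₂ a H.≈ proj₂ b)
  ; _+_     = λ a b → (proj₁ a G.+ proj₁ b) , (proj₂ a H.+ proj₂ b)
  ; zeroG   = G.zeroG , H.zeroG
  }
  where module G = PGroup G
        module H = PGroup H

module _ (G : PGroup) where
  open PGroup G

  mulN : ℕ → Carrier → Carrier
  mulN zero    x = zeroG
  mulN (suc k) x = x + mulN k x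

  IsTorsion : Carrier → Set
  IsTorsion x = ∃ λ (k : ℕ) → mulN (suc k) x ≈ zeroG

  Tors : Set
  Tors = Σ Carrier IsTorsion

record TorsIso (G H : PGroup) : Set where
  private
    module G = PGroup G
    module H = PGroup H
  field
    f     : Tors G → Tors H
    f-cong : ∀ (a b : Tors G) → proj₁ a G.≈ proj₁ b → proj₁ (f a) H.≈ proj₁ (f b)
    f-hom : ∀ (a b : Tors G) (pab : IsTorsion G (proj₁ a G.+ proj₁ b)) →
            proj₁ (f ((proj₁ a G.+ proj₁ b) , pab)) H.≈ (proj₁ (f a) H.+ proj₁ (f b))
    f-inj : ∀ (a b : Tors G) → proj₁ (f a) H.≈ proj₁ (f b) → proj₁ a G.≈ proj₁ b
    f-surj : ∀ (c : Tors H) → ∃ λ (a : Tors G) → proj₁ (f a) H.≈ proj₁ c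

JacY : (m : ℕ) → PGroup
JacY m = coker (lapY m)
-- (Jac is the torsion subgroup of this cokernel; see TorsIso / Tors.)

-- Write a vector of ℤ^{4n} in blocks v = (v₀, v₁, v₂, v₃), so that Lu = v reads
--   v₀ = 3u₀ − u₁ − u₂ − u₃,   vᵢ = A uᵢ − u₀  (i = 1, 2, 3).
-- The combination A v₀ + v₁ + v₂ + (3A − 2) v₃ eliminates u₀, u₁, u₂ and equals
-- 3(A² − A) u₃, while v₂ − v₃ = A (u₂ − u₃).  Hence
--   v ↦ (A v₀ + v₁ + v₂ + (3A − 2) v₃ , v₂ − v₃)
-- induces a map coker L → coker (3(A² − A)) ⊕ coker A.  It has the section
-- (w₁, w₂) ↦ (0, w₁ − w₂, w₂, 0), and both composites are the identity modulo
-- the relevant images, so it is an isomorphism of the whole cokernels and in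
-- particular of their torsion subgroups.
module Submission where

open import Defs
open import Data.Nat as ℕ using (ℕ; zero; suc)
open import Data.Integer as ℤ using (ℤ; +_; 0ℤ; 1ℤ; -_; _+_; _*_; _-_)
import Data.Integer.Properties as ℤ
open import Data.Integer.Tactic.RingSolver using (solve-∀)
open import Data.Fin as Fin using (Fin; _↑ˡ_; _↑ʳ_; combine; remQuot)
open import Data.Fin.Patterns using (0F; 1F; 2F; 3F)
open import Data.Fin.Properties using (remQuot-combine; combine-remQuot)
open import Data.Vec.Functional using ([]; _∷_)
open import Data.Bool using (true; false; if_then_else_)
open import Data.Product using (∃; _×_; _,_; proj₁; proj₂)
open import Function using (_∘_; flip)
open import Relation.Nullary using (yes; no)
open import Relation.Nullary.Decidable using (⌊_⌋)
open import Relation.Binary.PropositionalEquality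
open ≡-Reasoning
import Algebra.Properties.Semiring.Sum ℤ.+-*-semiring as Sum

∑≡sum : ∀ {N} (f : Fin N → ℤ) → ∑ f ≡ Sum.sum f
∑≡sum {zero}  f = refl
∑≡sum {suc N} f = cong (_+_ (f 0F)) (∑≡sum (f ∘ Fin.suc))

∑∑≡sum-sum : ∀ {K N} (f : Fin K → Fin N → ℤ) →
             ∑ (λ x → ∑ (f x)) ≡ Sum.sum (λ x → Sum.sum (f x))
∑∑≡sum-sum f = trans (∑≡sum (λ x → ∑ (f x))) (Sum.sum-cong-≗ (∑≡sum ∘ f))

∑-cong : ∀ {N} {f g : Fin N → ℤ} → f ≗ g → ∑ f ≡ ∑ g
∑-cong {f = f} {g} f≗g = begin
  ∑ f        ≡⟨ ∑≡sum f ⟩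
  Sum.sum f  ≡⟨ Sum.sum-cong-≗ f≗g ⟩
  Sum.sum g  ≡⟨ ∑≡sum g ⟨
  ∑ g        ∎

∑-zero : ∀ {N} → ∑ {N} (λ _ → 0ℤ) ≡ 0ℤ
∑-zero {N} = trans (∑≡sum {N} (λ _ → 0ℤ)) (Sum.sum-replicate-zero N)

∑-+ : ∀ {N} (f g : Fin N → ℤ) → ∑ (λ j → f j + g j) ≡ ∑ f + ∑ g
∑-+ f g = begin
  ∑ (λ j → f j + g j)        ≡⟨ ∑≡sum (λ j → f j + g j) ⟩
  Sum.sum (λ j → f j + g j)  ≡⟨ Sum.∑-distrib-+ f g ⟩
  Sum.sum f + Sum.sum g      ≡⟨ cong₂ _+_ (∑≡sum f) (∑≡sum g) ⟨
  ∑ f + ∑ g                  ∎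

∑-*ˡ : ∀ {N} c (f : Fin N → ℤ) → ∑ (λ j → c * f j) ≡ c * ∑ f
∑-*ˡ c f = begin
  ∑ (λ j → c * f j)        ≡⟨ ∑≡sum (λ j → c * f j) ⟩
  Sum.sum (λ j → c * f j)  ≡⟨ Sum.*-distribˡ-sum c f ⟨
  c * Sum.sum f            ≡⟨ cong (c *_) (∑≡sum f) ⟨
  c * ∑ f                  ∎

∑-*ʳ : ∀ {N} c (f : Fin N → ℤ) → ∑ (λ j → f j * c) ≡ ∑ f * c
∑-*ʳ c f = begin
  ∑ (λ j → f j * c)        ≡⟨ ∑≡sum (λ j → f j * c) ⟩
  Sum.sum (λ j → f j * c)  ≡⟨ Sum.*-distribʳ-sum c f ⟨
  Sum.sum f * c            ≡⟨ cong (_* c) (∑≡sum f) ⟨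
  ∑ f * c                  ∎

∑-comm : ∀ {K N} (f : Fin K → Fin N → ℤ) →
         ∑ (λ x → ∑ (f x)) ≡ ∑ (λ y → ∑ (λ x → f x y))
∑-comm f = begin
  ∑ (λ x → ∑ (f x))                      ≡⟨ ∑∑≡sum-sum f ⟩
  Sum.sum (λ x → Sum.sum (f x))          ≡⟨ Sum.∑-comm f ⟩
  Sum.sum (λ y → Sum.sum (flip f y))     ≡⟨ ∑∑≡sum-sum (flip f) ⟨
  ∑ (λ y → ∑ (λ x → f x y))              ∎

sum-↑ : ∀ K {N} (f : Fin (K ℕ.+ N) → ℤ) →
        Sum.sum f ≡ Sum.sum (f ∘ (_↑ˡ N)) + Sum.sum (f ∘ (K ↑ʳ_))
sum-↑ zero    f = sym (ℤ.+-identityˡ _)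
sum-↑ (suc K) {N} f = trans (cong (_+_ (f 0F)) (sum-↑ K (f ∘ Fin.suc)))
  (sym (ℤ.+-assoc (f 0F) (Sum.sum (f ∘ Fin.suc ∘ (_↑ˡ N))) (Sum.sum (f ∘ Fin.suc ∘ (K ↑ʳ_)))))

sum-combine : ∀ K {N} (f : Fin (K ℕ.* N) → ℤ) →
              Sum.sum f ≡ Sum.sum (λ x → Sum.sum (λ y → f (combine {K} {N} x y)))
sum-combine zero    f = refl
sum-combine (suc K) {N} f =
  trans (sum-↑ N f) (cong (_+_ (Sum.sum (f ∘ (_↑ˡ (K ℕ.* N))))) (sum-combine K (f ∘ (N ↑ʳ_))))

∑-combine : ∀ K {N} (f : Fin (K ℕ.* N) → ℤ) →
            ∑ f ≡ ∑ (λ x → ∑ (λ y → f (combine {K} {N} x y)))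
∑-combine K f =
  trans (∑≡sum f) (trans (sum-combine K f) (sym (∑∑≡sum-sum (λ x y → f (combine {K} x y)))))

infixl 6 _+ᵥ_ _-ᵥ_
infixr 7 _•_

_+ᵥ_ _-ᵥ_ : ∀ {N} → ZVec N → ZVec N → ZVec N
(v +ᵥ w) i = v i + w i
(v -ᵥ w) i = v i - w i

_•_ : ∀ {N} → ℤ → ZVec N → ZVec N
(c • v) i = c * v i

0ᵥ : ∀ {N} → ZVec N
0ᵥ _ = 0ℤ

record IsLinear {M N} (φ : ZVec M → ZVec N) : Set where
  field
    cong-≗ : ∀ {v w} → v ≗ w → φ v ≗ φ w
    +-homo : ∀ v w → φ (v +ᵥ w) ≗ φ v +ᵥ φ w
    *-homo : ∀ c v → φ (c • v) ≗ c • φ v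

  −-homo : ∀ v w → φ (v -ᵥ w) ≗ φ v -ᵥ φ w
  −-homo v w i = begin
    φ (v -ᵥ w) i                ≡⟨ cong-≗ (λ j → cong (_+_ (v j)) (sym (ℤ.-1*i≡-i (w j)))) i ⟩
    φ (v +ᵥ - 1ℤ • w) i         ≡⟨ +-homo v (- 1ℤ • w) i ⟩
    φ v i + φ (- 1ℤ • w) i      ≡⟨ cong (_+_ (φ v i)) (*-homo (- 1ℤ) w i) ⟩
    φ v i + - 1ℤ * φ w i        ≡⟨ cong (_+_ (φ v i)) (ℤ.-1*i≡-i (φ w i)) ⟩
    φ v i - φ w i               ∎

open IsLinear

module _ {M N} {φ ψ : ZVec M → ZVec N} (φ-lin : IsLinear φ) (ψ-lin : IsLinear ψ) where
  private
    module φ = IsLinear φ-lin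
    module ψ = IsLinear ψ-lin

  +ᵥ-linear : IsLinear (λ v → φ v +ᵥ ψ v)
  +ᵥ-linear = record
    { cong-≗ = λ v≗w i → cong₂ _+_ (φ.cong-≗ v≗w i) (ψ.cong-≗ v≗w i)
    ; +-homo = λ v w i → trans (cong₂ _+_ (φ.+-homo v w i) (ψ.+-homo v w i))
                               (interchange (φ v i) (φ w i) (ψ v i) (ψ w i))
    ; *-homo = λ c v i → trans (cong₂ _+_ (φ.*-homo c v i) (ψ.*-homo c v i))
                               (sym (ℤ.*-distribˡ-+ c (φ v i) (ψ v i)))
    }
    where
    interchange : ∀ a b c d → a + b + (c + d) ≡ a + c + (b + d)
    interchange = solve-∀

  -ᵥ-linear : IsLinear (λ v → φ v -ᵥ ψ v)
  -ᵥ-linear = record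
    { cong-≗ = λ v≗w i → cong₂ _-_ (φ.cong-≗ v≗w i) (ψ.cong-≗ v≗w i)
    ; +-homo = λ v w i → trans (cong₂ _-_ (φ.+-homo v w i) (ψ.+-homo v w i))
                               (interchange (φ v i) (φ w i) (ψ v i) (ψ w i))
    ; *-homo = λ c v i → trans (cong₂ _-_ (φ.*-homo c v i) (ψ.*-homo c v i))
                               (distrib c (φ v i) (ψ v i))
    }
    where
    interchange : ∀ a b c d → a + b - (c + d) ≡ a - c + (b - d)
    interchange = solve-∀
    distrib : ∀ c a b → c * a - c * b ≡ c * (a - b)
    distrib = solve-∀

module _ {L M N} {φ : ZVec M → ZVec N} {ψ : ZVec L → ZVec M}
         (φ-lin : IsLinear φ) (ψ-lin : IsLinear ψ) where
  private
    module φ = IsLinear φ-lin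
    module ψ = IsLinear ψ-lin

  ∘-linear : IsLinear (φ ∘ ψ)
  ∘-linear = record
    { cong-≗ = φ.cong-≗ ∘ ψ.cong-≗
    ; +-homo = λ v w i → trans (φ.cong-≗ (ψ.+-homo v w) i) (φ.+-homo (ψ v) (ψ w) i)
    ; *-homo = λ c v i → trans (φ.cong-≗ (ψ.*-homo c v) i) (φ.*-homo c (ψ v) i)
    }

•-linear : ∀ {M N} {φ : ZVec M → ZVec N} k → IsLinear φ → IsLinear (λ v → k • φ v)
•-linear {φ = φ} k φ-lin = record
  { cong-≗ = λ v≗w i → cong (_*_ k) (cong-≗ φ-lin v≗w i)
  ; +-homo = λ v w i → trans (cong (_*_ k) (+-homo φ-lin v w i))
                             (ℤ.*-distribˡ-+ k (φ v i) (φ w i))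
  ; *-homo = λ c v i → trans (cong (_*_ k) (*-homo φ-lin c v i)) (swap-factor k c (φ v i))
  }
  where
  swap-factor : ∀ k c x → k * (c * x) ≡ c * (k * x)
  swap-factor = solve-∀

·ᵥ-linear : ∀ {N} (X : Mat N) → IsLinear (X ·ᵥ_)
·ᵥ-linear X = record
  { cong-≗ = λ v≗w i → ∑-cong (λ j → cong (X i j *_) (v≗w j))
  ; +-homo = λ v w i → trans (∑-cong (λ j → ℤ.*-distribˡ-+ (X i j) (v j) (w j)))
                             (∑-+ (λ j → X i j * v j) (λ j → X i j * w j))
  ; *-homo = λ c v i → trans (∑-cong (λ j → swap-factor (X i j) c (v j)))
                             (∑-*ˡ c (λ j → X i j * v j))
  }
  where
  swap-factor : ∀ x c y → x * (c * y) ≡ c * (x * y)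
  swap-factor = solve-∀

module _ {N} (X : Mat N) where
  open IsLinear (·ᵥ-linear X) public
    renaming (cong-≗ to ·ᵥ-cong; +-homo to ·ᵥ-+; *-homo to ·ᵥ-*; −-homo to ·ᵥ-−)

  ·ᵥ-0ᵥ : X ·ᵥ 0ᵥ ≗ 0ᵥ
  ·ᵥ-0ᵥ i = trans (∑-cong (λ j → ℤ.*-zeroʳ (X i j))) (∑-zero {N})

0ₘ-·ᵥ : ∀ {N} (v : ZVec N) → 0ₘ ·ᵥ v ≗ 0ᵥ
0ₘ-·ᵥ {N} v i = trans (∑-cong (λ j → ℤ.*-zeroˡ (v j))) (∑-zero {N})

Iₘ-suc : ∀ {N} (i j : Fin N) → Iₘ (Fin.suc i) (Fin.suc j) ≡ Iₘ i j
Iₘ-suc i j with i Fin.≟ j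
... | yes _ = refl
... | no  _ = refl

Iₘ-·ᵥ : ∀ {N} (v : ZVec N) → Iₘ ·ᵥ v ≗ v
Iₘ-·ᵥ {suc N} v 0F = begin
  1ℤ * v 0F + ∑ (λ j → 0ℤ * v (Fin.suc j))
    ≡⟨ cong₂ _+_ (ℤ.*-identityˡ (v 0F)) (trans (∑-cong (ℤ.*-zeroˡ ∘ v ∘ Fin.suc)) (∑-zero {N})) ⟩
  v 0F + 0ℤ
    ≡⟨ ℤ.+-identityʳ (v 0F) ⟩
  v 0F ∎
Iₘ-·ᵥ {suc N} v (Fin.suc i) = begin
  0ℤ * v 0F + ∑ (λ j → Iₘ (Fin.suc i) (Fin.suc j) * v (Fin.suc j))
    ≡⟨ ℤ.+-identityˡ _ ⟩
  ∑ (λ j → Iₘ (Fin.suc i) (Fin.suc j) * v (Fin.suc j))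
    ≡⟨ ∑-cong (λ j → cong (_* v (Fin.suc j)) (Iₘ-suc i j)) ⟩
  (Iₘ ·ᵥ (v ∘ Fin.suc)) i
    ≡⟨ Iₘ-·ᵥ (v ∘ Fin.suc) i ⟩
  v (Fin.suc i) ∎

·ₘ-·ᵥ : ∀ {N} c (X : Mat N) v → (c ·ₘ X) ·ᵥ v ≗ c • (X ·ᵥ v)
·ₘ-·ᵥ c X v i = trans (∑-cong (λ j → ℤ.*-assoc c (X i j) (v j))) (∑-*ˡ c (λ j → X i j * v j))

scaledIₘ-·ᵥ : ∀ {N} c (v : ZVec N) → (c ·ₘ Iₘ) ·ᵥ v ≗ c • v
scaledIₘ-·ᵥ c v i = trans (·ₘ-·ᵥ c Iₘ v i) (cong (c *_) (Iₘ-·ᵥ v i))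

-ₘ-·ᵥ : ∀ {N} (X Y : Mat N) v → (X -ₘ Y) ·ᵥ v ≗ X ·ᵥ v -ᵥ Y ·ᵥ v
-ₘ-·ᵥ X Y v i = begin
  ∑ (λ j → (X i j - Y i j) * v j)
    ≡⟨ ∑-cong (λ j → distrib (X i j) (Y i j) (v j)) ⟩
  ∑ (λ j → X i j * v j + - 1ℤ * (Y i j * v j))
    ≡⟨ trans (∑-+ (λ j → X i j * v j) (λ j → - 1ℤ * (Y i j * v j)))
         (cong (_+_ ((X ·ᵥ v) i)) (∑-*ˡ (- 1ℤ) (λ j → Y i j * v j))) ⟩
  (X ·ᵥ v) i + - 1ℤ * (Y ·ᵥ v) i
    ≡⟨ cong (_+_ ((X ·ᵥ v) i)) (ℤ.-1*i≡-i _) ⟩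
  (X ·ᵥ v) i - (Y ·ᵥ v) i ∎
  where
  distrib : ∀ x y z → (x - y) * z ≡ x * z + - 1ℤ * (y * z)
  distrib = solve-∀

*ₘ-·ᵥ : ∀ {N} (X Y : Mat N) v → (X *ₘ Y) ·ᵥ v ≗ X ·ᵥ (Y ·ᵥ v)
*ₘ-·ᵥ X Y v i = begin
  ∑ (λ k → ∑ (λ j → X i j * Y j k) * v k)
    ≡⟨ ∑-cong (λ k → sym (∑-*ʳ (v k) (λ j → X i j * Y j k))) ⟩
  ∑ (λ k → ∑ (λ j → X i j * Y j k * v k))
    ≡⟨ sym (∑-comm (λ j k → X i j * Y j k * v k)) ⟩
  ∑ (λ j → ∑ (λ k → X i j * Y j k * v k))
    ≡⟨ ∑-cong (λ j → trans (∑-cong (λ k → ℤ.*-assoc (X i j) (Y j k) (v k)))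
                           (∑-*ˡ (X i j) (λ k → Y j k * v k))) ⟩
  ∑ (λ j → X i j * (Y ·ᵥ v) j) ∎

if-·ᵥ : ∀ {N} b (X : Mat N) v i →
        ((if b then X else 0ₘ) ·ᵥ v) i ≡ (if b then 1ℤ else 0ℤ) * (X ·ᵥ v) i
if-·ᵥ true  X v i = sym (ℤ.*-identityˡ _)
if-·ᵥ false X v i = 0ₘ-·ᵥ v i

infix 4 _∈Im_

_∈Im_ : ∀ {N} → ZVec N → Mat N → Set
v ∈Im X = ∃ λ u → v ≗ X ·ᵥ u

module _ {N} (X : Mat N) where
  open PGroup (coker X) using (_≈_)

  ∈Im-resp-≗ : ∀ {v w} → v ≗ w → v ∈Im X → w ∈Im X
  ∈Im-resp-≗ v≗w (u , v≗Xu) = u , λ i → trans (sym (v≗w i)) (v≗Xu i)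

  0ᵥ∈Im : 0ᵥ ∈Im X
  0ᵥ∈Im = 0ᵥ , λ i → sym (·ᵥ-0ᵥ X i)

  ∈Im-+ : ∀ {v w} → v ∈Im X → w ∈Im X → v +ᵥ w ∈Im X
  ∈Im-+ (u , v≗Xu) (u' , w≗Xu') =
    u +ᵥ u' , λ i → trans (cong₂ _+_ (v≗Xu i) (w≗Xu' i)) (sym (·ᵥ-+ X u u' i))

  ≗⇒≈ : ∀ {v w} → v ≗ w → v ≈ w
  ≗⇒≈ {w = w} v≗w =
    ∈Im-resp-≗ (λ i → sym (trans (cong (_- w i) (v≗w i)) (ℤ.+-inverseʳ (w i)))) 0ᵥ∈Im

  mulN-coker : ∀ k v → mulN (coker X) k v ≗ + k • v
  mulN-coker zero    v i = sym (ℤ.*-zeroˡ (v i))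
  mulN-coker (suc k) v i = trans (cong (_+_ (v i)) (mulN-coker k v i)) (sym (ℤ.suc-* (+ k) (v i)))

  mulN≈0⇒∈Im : ∀ {k v} → mulN (coker X) k v ≈ 0ᵥ → + k • v ∈Im X
  mulN≈0⇒∈Im {k} {v} = ∈Im-resp-≗ (λ i → trans (ℤ.+-identityʳ _) (mulN-coker k v i))

  ∈Im⇒mulN≈0 : ∀ {k v} → + k • v ∈Im X → mulN (coker X) k v ≈ 0ᵥ
  ∈Im⇒mulN≈0 {k} {v} = ∈Im-resp-≗ (λ i → sym (trans (ℤ.+-identityʳ _) (mulN-coker k v i)))

module _ (G H : PGroup) where
  private
    module G = PGroup G
    module H = PGroup H

  mulN-⊕ : ∀ k a b → mulN (G ⊕ H) k (a , b) ≡ (mulN G k a , mulN H k b)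
  mulN-⊕ zero    a b = refl
  mulN-⊕ (suc k) a b = cong (λ p → a G.+ proj₁ p , b H.+ proj₂ p) (mulN-⊕ k a b)

  private
    BothZero : G.Carrier × H.Carrier → Set
    BothZero p = (proj₁ p G.≈ G.zeroG) × (proj₂ p H.≈ H.zeroG)

  mulN-⊕≈0⁺ : ∀ k a b → mulN G k a G.≈ G.zeroG → mulN H k b H.≈ H.zeroG →
              PGroup._≈_ (G ⊕ H) (mulN (G ⊕ H) k (a , b)) (PGroup.zeroG (G ⊕ H))
  mulN-⊕≈0⁺ k a b ka≈0 kb≈0 = subst BothZero (sym (mulN-⊕ k a b)) (ka≈0 , kb≈0)

  mulN-⊕≈0⁻ : ∀ k a b → PGroup._≈_ (G ⊕ H) (mulN (G ⊕ H) k (a , b)) (PGroup.zeroG (G ⊕ H)) →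
              (mulN G k a G.≈ G.zeroG) × (mulN H k b H.≈ H.zeroG)
  mulN-⊕≈0⁻ k a b = subst BothZero (mulN-⊕ k a b)

record CokerSplitting {M N₁ N₂} (X : Mat M) (Y : Mat N₁) (Z : Mat N₂) : Set where
  field
    to₁        : ZVec M → ZVec N₁
    to₂        : ZVec M → ZVec N₂
    from       : ZVec N₁ → ZVec N₂ → ZVec M
    to₁-linear : IsLinear to₁
    to₂-linear : IsLinear to₂
    from-*     : ∀ c w₁ w₂ → from (c • w₁) (c • w₂) ≗ c • from w₁ w₂
    to₁-image  : ∀ {v} → v ∈Im X → to₁ v ∈Im Y
    to₂-image  : ∀ {v} → v ∈Im X → to₂ v ∈Im Z
    from-image : ∀ {w₁ w₂} → w₁ ∈Im Y → w₂ ∈Im Z → from w₁ w₂ ∈Im X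
    to₁-from   : ∀ w₁ w₂ → to₁ (from w₁ w₂) ≗ w₁
    to₂-from   : ∀ w₁ w₂ → to₂ (from w₁ w₂) ≗ w₂
    from-to    : ∀ v → v -ᵥ from (to₁ v) (to₂ v) ∈Im X

module _ {M N₁ N₂} {X : Mat M} {Y : Mat N₁} {Z : Mat N₂} (S : CokerSplitting X Y Z) where
  open CokerSplitting S
  private
    module CX = PGroup (coker X)
    module CYZ = PGroup (coker Y ⊕ coker Z)

    to : ZVec M → ZVec N₁ × ZVec N₂
    to v = to₁ v , to₂ v

    to-cong : ∀ {v w} → v CX.≈ w → to v CYZ.≈ to w
    to-cong {v} {w} v-w∈ImX =
        ∈Im-resp-≗ Y (−-homo to₁-linear v w) (to₁-image v-w∈ImX)
      , ∈Im-resp-≗ Z (−-homo to₂-linear v w) (to₂-image v-w∈ImX)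

    to-+ : ∀ v w → to (v CX.+ w) CYZ.≈ (to v CYZ.+ to w)
    to-+ v w = ≗⇒≈ Y (+-homo to₁-linear v w) , ≗⇒≈ Z (+-homo to₂-linear v w)

    to-torsion : ∀ {v} → IsTorsion (coker X) v → IsTorsion (coker Y ⊕ coker Z) (to v)
    to-torsion {v} (k , kv≈0) = k , mulN-⊕≈0⁺ (coker Y) (coker Z) (suc k) (to₁ v) (to₂ v)
      (∈Im⇒mulN≈0 Y {suc k} (∈Im-resp-≗ Y (*-homo to₁-linear (+ suc k) v) (to₁-image kv∈ImX)))
      (∈Im⇒mulN≈0 Z {suc k} (∈Im-resp-≗ Z (*-homo to₂-linear (+ suc k) v) (to₂-image kv∈ImX)))
      where
      kv∈ImX : + suc k • v ∈Im X
      kv∈ImX = mulN≈0⇒∈Im X {suc k} kv≈0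

    -- v − w = (d − from (to d)) + from (to d) with d = v − w, and to d ∈ im Y × im Z.
    to-injective : ∀ {v w} → to v CYZ.≈ to w → v CX.≈ w
    to-injective {v} {w} (to₁v-to₁w∈ImY , to₂v-to₂w∈ImZ) =
      ∈Im-resp-≗ X (λ i → sub-add (d i) _)
        (∈Im-+ X (from-to d) (from-image
          (∈Im-resp-≗ Y (λ i → sym (−-homo to₁-linear v w i)) to₁v-to₁w∈ImY)
          (∈Im-resp-≗ Z (λ i → sym (−-homo to₂-linear v w i)) to₂v-to₂w∈ImZ)))
      where
      d : ZVec M
      d = v -ᵥ w
      sub-add : ∀ x y → x - y + y ≡ x
      sub-add = solve-∀

    from-torsion : ∀ {w₁ w₂} → IsTorsion (coker Y ⊕ coker Z) (w₁ , w₂) →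
                   IsTorsion (coker X) (from w₁ w₂)
    from-torsion {w₁} {w₂} (k , kw≈0) with mulN-⊕≈0⁻ (coker Y) (coker Z) (suc k) w₁ w₂ kw≈0
    ... | kw₁≈0 , kw₂≈0 = k , ∈Im⇒mulN≈0 X {suc k} (∈Im-resp-≗ X (from-* (+ suc k) w₁ w₂)
      (from-image (mulN≈0⇒∈Im Y {suc k} kw₁≈0) (mulN≈0⇒∈Im Z {suc k} kw₂≈0)))

    to-from : ∀ w₁ w₂ → to (from w₁ w₂) CYZ.≈ (w₁ , w₂)
    to-from w₁ w₂ = ≗⇒≈ Y (to₁-from w₁ w₂) , ≗⇒≈ Z (to₂-from w₁ w₂)

  splitting⇒TorsIso : TorsIso (coker X) (coker Y ⊕ coker Z)
  splitting⇒TorsIso = record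
    { f      = λ (v , t) → to v , to-torsion t
    ; f-cong = λ _ _ → to-cong
    ; f-hom  = λ (v , _) (w , _) _ → to-+ v w
    ; f-inj  = λ _ _ → to-injective
    ; f-surj = λ ((w₁ , w₂) , t) → (from w₁ w₂ , from-torsion t) , to-from w₁ w₂
    }

module Blocks (K n : ℕ) where

  part : ZVec (K ℕ.* n) → Fin K → ZVec n
  part v x y = v (combine x y)

  assemble : (Fin K → ZVec n) → ZVec (K ℕ.* n)
  assemble c p = c (proj₁ (remQuot {K} n p)) (proj₂ (remQuot {K} n p))

  _HasBlocks_ : ZVec (K ℕ.* n) → (Fin K → ZVec n) → Set
  v HasBlocks c = ∀ x → part v x ≗ c x

  assemble-blocks : ∀ c → assemble c HasBlocks c
  assemble-blocks c x y = cong (λ r → c (proj₁ r) (proj₂ r)) (remQuot-combine {K} x y)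

  assemble-cong : ∀ {c d} → (∀ x → c x ≗ d x) → assemble c ≗ assemble d
  assemble-cong c≗d p = c≗d (proj₁ (remQuot {K} n p)) (proj₂ (remQuot {K} n p))

  ≗-by-blocks : ∀ {v w c d} → v HasBlocks c → w HasBlocks d → (∀ x → c x ≗ d x) → v ≗ w
  ≗-by-blocks {v} {w} v=c w=d c≗d p = subst (λ q → v q ≡ w q) (combine-remQuot {K} n p)
    (trans (v=c x y) (trans (c≗d x y) (sym (w=d x y))))
    where
    x = proj₁ (remQuot {K} n p)
    y = proj₂ (remQuot {K} n p)

  blocks-part : ∀ v → v HasBlocks part v
  blocks-part v _ _ = refl

  -ᵥ-blocks : ∀ {v w c d} → v HasBlocks c → w HasBlocks d → (v -ᵥ w) HasBlocks (λ x → c x -ᵥ d x)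
  -ᵥ-blocks v=c w=d x y = cong₂ _-_ (v=c x y) (w=d x y)

  part-linear : ∀ x → IsLinear (λ v → part v x)
  part-linear x = record
    { cong-≗ = λ v≗w y → v≗w (combine x y)
    ; +-homo = λ _ _ _ → refl
    ; *-homo = λ _ _ _ → refl
    }

module _ {n : ℕ} (Bl : Fin 4 → Fin 4 → Mat n) where
  open Blocks 4 n

  private
    block4-remQuot : ∀ p q → block4 Bl p q ≡
      Bl (proj₁ (remQuot n p)) (proj₁ (remQuot n q)) (proj₂ (remQuot n p)) (proj₂ (remQuot n q))
    block4-remQuot p q with remQuot {4} n p | remQuot {4} n q
    ... | _ , _ | _ , _ = refl

  block4-combine : ∀ x y x' y' → block4 Bl (combine x y) (combine x' y') ≡ Bl x x' y y'
  block4-combine x y x' y' = trans (block4-remQuot (combine x y) (combine x' y'))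
    (cong₂ (λ r r' → Bl (proj₁ r) (proj₁ r') (proj₂ r) (proj₂ r'))
           (remQuot-combine x y) (remQuot-combine x' y'))

  block4-·ᵥ : ∀ u x → part (block4 Bl ·ᵥ u) x ≗ λ y → ∑ (λ x' → (Bl x x' ·ᵥ part u x') y)
  block4-·ᵥ u x y = trans (∑-combine 4 {n} (λ p → block4 Bl (combine x y) p * u p))
    (∑-cong (λ x' → ∑-cong (λ y' → cong (_* u (combine x' y')) (block4-combine x y x' y'))))

module Y111 (m : ℕ) where
  n : ℕ
  n = suc m

  open Blocks 4 n

  A B : Mat n
  A = matA m
  B = (+ 3) ·ₘ ((A *ₘ A) -ₘ A)

  L : Mat (4 ℕ.* n)
  L = lapY m

  B-·ᵥ : ∀ s → B ·ᵥ s ≗ + 3 • (A ·ᵥ (A ·ᵥ s) -ᵥ A ·ᵥ s)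
  B-·ᵥ s y = begin
    (B ·ᵥ s) y                               ≡⟨ ·ₘ-·ᵥ (+ 3) ((A *ₘ A) -ₘ A) s y ⟩
    + 3 * (((A *ₘ A) -ₘ A) ·ᵥ s) y           ≡⟨ cong (_*_ (+ 3)) (-ₘ-·ᵥ (A *ₘ A) A s y) ⟩
    + 3 * (((A *ₘ A) ·ᵥ s) y - (A ·ᵥ s) y)   ≡⟨ cong (λ z → + 3 * (z - (A ·ᵥ s) y)) (*ₘ-·ᵥ A A s y) ⟩
    + 3 * ((A ·ᵥ (A ·ᵥ s)) y - (A ·ᵥ s) y)   ∎

  Lrows : (Fin 4 → ZVec n) → Fin 4 → ZVec n
  Lrows c = + 3 • c 0F -ᵥ c 1F -ᵥ c 2F -ᵥ c 3F
          ∷ A ·ᵥ c 1F -ᵥ c 0F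
          ∷ A ·ᵥ c 2F -ᵥ c 0F
          ∷ A ·ᵥ c 3F -ᵥ c 0F
          ∷ []

  module _ {u : ZVec (4 ℕ.* n)} {c : Fin 4 → ZVec n} (u=c : u HasBlocks c) where
    private
      scaled-Iₘ : ∀ k x y → ((k ·ₘ Iₘ) ·ᵥ part u x) y ≡ k * c x y
      scaled-Iₘ k x y = trans (scaledIₘ-·ᵥ k (part u x) y) (cong (_*_ k) (u=c x y))

      L-row₀ : part (L ·ᵥ u) 0F ≗ Lrows c 0F
      L-row₀ y = begin
        part (L ·ᵥ u) 0F y
          ≡⟨ block4-·ᵥ (lapBlocks m) u 0F y ⟩
        (((+ 3) ·ₘ Iₘ) ·ᵥ part u 0F) y + ∑ (λ j → (((- 1ℤ) ·ₘ Iₘ) ·ᵥ part u (Fin.suc j)) y)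
          ≡⟨ cong₂ _+_ (scaled-Iₘ (+ 3) 0F y) (∑-cong (λ j → scaled-Iₘ (- 1ℤ) (Fin.suc j) y)) ⟩
        + 3 * c 0F y + (- 1ℤ * c 1F y + (- 1ℤ * c 2F y + (- 1ℤ * c 3F y + 0ℤ)))
          ≡⟨ row (c 0F y) (c 1F y) (c 2F y) (c 3F y) ⟩
        Lrows c 0F y ∎
        where
        row : ∀ a b c d → + 3 * a + (- 1ℤ * b + (- 1ℤ * c + (- 1ℤ * d + 0ℤ))) ≡ + 3 * a - b - c - d
        row = solve-∀

      L-row-suc : ∀ i → part (L ·ᵥ u) (Fin.suc i) ≗ A ·ᵥ c (Fin.suc i) -ᵥ c 0F
      L-row-suc i y = begin
        part (L ·ᵥ u) (Fin.suc i) y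
          ≡⟨ block4-·ᵥ (lapBlocks m) u (Fin.suc i) y ⟩
        (((- 1ℤ) ·ₘ Iₘ) ·ᵥ part u 0F) y
          + ∑ (λ j → ((if ⌊ i Fin.≟ j ⌋ then A else 0ₘ) ·ᵥ part u (Fin.suc j)) y)
          ≡⟨ cong₂ _+_ (scaled-Iₘ (- 1ℤ) 0F y) (∑-cong (λ j →
               trans (if-·ᵥ ⌊ i Fin.≟ j ⌋ A (part u (Fin.suc j)) y)
                     (cong (_*_ (Iₘ i j)) (·ᵥ-cong A (u=c (Fin.suc j)) y)))) ⟩
        - 1ℤ * c 0F y + (Iₘ ·ᵥ (λ j → (A ·ᵥ c (Fin.suc j)) y)) i
          ≡⟨ cong (_+_ (- 1ℤ * c 0F y)) (Iₘ-·ᵥ (λ j → (A ·ᵥ c (Fin.suc j)) y) i) ⟩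
        - 1ℤ * c 0F y + (A ·ᵥ c (Fin.suc i)) y
          ≡⟨ row (c 0F y) ((A ·ᵥ c (Fin.suc i)) y) ⟩
        (A ·ᵥ c (Fin.suc i)) y - c 0F y ∎
        where
        row : ∀ a b → - 1ℤ * a + b ≡ b - a
        row = solve-∀

    L·ᵥ-blocks : (L ·ᵥ u) HasBlocks Lrows c
    L·ᵥ-blocks 0F = L-row₀
    L·ᵥ-blocks 1F = L-row-suc 0F
    L·ᵥ-blocks 2F = L-row-suc 1F
    L·ᵥ-blocks 3F = L-row-suc 2F

  eliminant : (Fin 4 → ZVec n) → ZVec n
  eliminant c = A ·ᵥ c 0F +ᵥ c 1F +ᵥ c 2F +ᵥ + 3 • A ·ᵥ c 3F -ᵥ + 2 • c 3F

  eliminant-cong : ∀ {c d} → (∀ x → c x ≗ d x) → eliminant c ≗ eliminant d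
  eliminant-cong c≗d y =
    cong₂ _-_ (cong₂ _+_ (cong₂ _+_ (cong₂ _+_ (·ᵥ-cong A (c≗d 0F) y) (c≗d 1F y)) (c≗d 2F y))
                         (cong (_*_ (+ 3)) (·ᵥ-cong A (c≗d 3F) y)))
              (cong (_*_ (+ 2)) (c≗d 3F y))

  to₁ to₂ : ZVec (4 ℕ.* n) → ZVec n
  to₁ v = eliminant (part v)
  to₂ v = part v 2F -ᵥ part v 3F

  section-blocks : ZVec n → ZVec n → Fin 4 → ZVec n
  section-blocks w₁ w₂ = 0ᵥ ∷ w₁ -ᵥ w₂ ∷ w₂ ∷ 0ᵥ ∷ []

  from : ZVec n → ZVec n → ZVec (4 ℕ.* n)
  from w₁ w₂ = assemble (section-blocks w₁ w₂)

  to₁-linear : IsLinear to₁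
  to₁-linear =
    -ᵥ-linear (+ᵥ-linear (+ᵥ-linear (+ᵥ-linear
      (∘-linear (·ᵥ-linear A) (part-linear 0F)) (part-linear 1F)) (part-linear 2F))
      (•-linear (+ 3) (∘-linear (·ᵥ-linear A) (part-linear 3F))))
      (•-linear (+ 2) (part-linear 3F))

  to₂-linear : IsLinear to₂
  to₂-linear = -ᵥ-linear (part-linear 2F) (part-linear 3F)

  to₁-L : ∀ u → to₁ (L ·ᵥ u) ≗ B ·ᵥ part u 3F
  to₁-L u y = begin
    to₁ (L ·ᵥ u) y
      ≡⟨ eliminant-cong (L·ᵥ-blocks {u} (blocks-part u)) y ⟩
    a (+ 3 • u₀ -ᵥ u₁ -ᵥ u₂ -ᵥ u₃) + (a u₁ - u₀ y) + (a u₂ - u₀ y)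
      + + 3 * a (A ·ᵥ u₃ -ᵥ u₀) - + 2 * (a u₃ - u₀ y)
      ≡⟨ cong₂ (λ p q → p + (a u₁ - u₀ y) + (a u₂ - u₀ y) + + 3 * q - + 2 * (a u₃ - u₀ y))
               expand₀ (·ᵥ-− A (A ·ᵥ u₃) u₀ y) ⟩
    (+ 3 * a u₀ - a u₁ - a u₂ - a u₃) + (a u₁ - u₀ y) + (a u₂ - u₀ y)
      + + 3 * (a (A ·ᵥ u₃) - a u₀) - + 2 * (a u₃ - u₀ y)
      ≡⟨ eliminate (a u₀) (a u₁) (a u₂) (a u₃) (a (A ·ᵥ u₃)) (u₀ y) ⟩
    + 3 * (a (A ·ᵥ u₃) - a u₃)
      ≡⟨ B-·ᵥ u₃ y ⟨
    (B ·ᵥ u₃) y ∎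
    where
    u₀ u₁ u₂ u₃ : ZVec n
    u₀ = part u 0F
    u₁ = part u 1F
    u₂ = part u 2F
    u₃ = part u 3F
    a : ZVec n → ℤ
    a w = (A ·ᵥ w) y
    expand₀ : a (+ 3 • u₀ -ᵥ u₁ -ᵥ u₂ -ᵥ u₃) ≡ + 3 * a u₀ - a u₁ - a u₂ - a u₃
    expand₀ = begin
      a (+ 3 • u₀ -ᵥ u₁ -ᵥ u₂ -ᵥ u₃)     ≡⟨ ·ᵥ-− A (+ 3 • u₀ -ᵥ u₁ -ᵥ u₂) u₃ y ⟩
      a (+ 3 • u₀ -ᵥ u₁ -ᵥ u₂) - a u₃    ≡⟨ cong (_- a u₃) (·ᵥ-− A (+ 3 • u₀ -ᵥ u₁) u₂ y) ⟩
      a (+ 3 • u₀ -ᵥ u₁) - a u₂ - a u₃   ≡⟨ cong (λ z → z - a u₂ - a u₃) (·ᵥ-− A (+ 3 • u₀) u₁ y) ⟩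
      a (+ 3 • u₀) - a u₁ - a u₂ - a u₃  ≡⟨ cong (λ z → z - a u₁ - a u₂ - a u₃) (·ᵥ-* A (+ 3) u₀ y) ⟩
      + 3 * a u₀ - a u₁ - a u₂ - a u₃    ∎
    eliminate : ∀ b₀ b₁ b₂ b₃ c₃ x₀ →
      (+ 3 * b₀ - b₁ - b₂ - b₃) + (b₁ - x₀) + (b₂ - x₀) + + 3 * (c₃ - b₀) - + 2 * (b₃ - x₀)
        ≡ + 3 * (c₃ - b₃)
    eliminate = solve-∀

  to₂-L : ∀ u → to₂ (L ·ᵥ u) ≗ A ·ᵥ (part u 2F -ᵥ part u 3F)
  to₂-L u y = begin
    to₂ (L ·ᵥ u) y
      ≡⟨ cong₂ _-_ (L·ᵥ-blocks {u} (blocks-part u) 2F y) (L·ᵥ-blocks {u} (blocks-part u) 3F y) ⟩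
    ((A ·ᵥ u₂) y - u₀ y) - ((A ·ᵥ u₃) y - u₀ y)
      ≡⟨ cancel ((A ·ᵥ u₂) y) ((A ·ᵥ u₃) y) (u₀ y) ⟩
    (A ·ᵥ u₂) y - (A ·ᵥ u₃) y
      ≡⟨ ·ᵥ-− A u₂ u₃ y ⟨
    (A ·ᵥ (u₂ -ᵥ u₃)) y ∎
    where
    u₀ u₂ u₃ : ZVec n
    u₀ = part u 0F
    u₂ = part u 2F
    u₃ = part u 3F
    cancel : ∀ b c x → (b - x) - (c - x) ≡ b - c
    cancel = solve-∀

  to₁-image : ∀ {v} → v ∈Im L → to₁ v ∈Im B
  to₁-image (u , v≗Lu) = part u 3F , λ y → trans (cong-≗ to₁-linear v≗Lu y) (to₁-L u y)

  to₂-image : ∀ {v} → v ∈Im L → to₂ v ∈Im A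
  to₂-image (u , v≗Lu) = part u 2F -ᵥ part u 3F , λ y → trans (cong-≗ to₂-linear v≗Lu y) (to₂-L u y)

  to₁-from : ∀ w₁ w₂ → to₁ (from w₁ w₂) ≗ w₁
  to₁-from w₁ w₂ y = begin
    to₁ (from w₁ w₂) y
      ≡⟨ eliminant-cong (assemble-blocks (section-blocks w₁ w₂)) y ⟩
    (A ·ᵥ 0ᵥ) y + (w₁ y - w₂ y) + w₂ y + + 3 * (A ·ᵥ 0ᵥ) y - + 2 * 0ℤ
      ≡⟨ cong (λ z → z + (w₁ y - w₂ y) + w₂ y + + 3 * z - + 2 * 0ℤ) (·ᵥ-0ᵥ A y) ⟩
    0ℤ + (w₁ y - w₂ y) + w₂ y + + 3 * 0ℤ - + 2 * 0ℤ
      ≡⟨ simplify (w₁ y) (w₂ y) ⟩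
    w₁ y ∎
    where
    simplify : ∀ a b → 0ℤ + (a - b) + b + + 3 * 0ℤ - + 2 * 0ℤ ≡ a
    simplify = solve-∀

  to₂-from : ∀ w₁ w₂ → to₂ (from w₁ w₂) ≗ w₂
  to₂-from w₁ w₂ y = trans (cong₂ _-_ (blocks 2F y) (blocks 3F y)) (ℤ.+-identityʳ (w₂ y))
    where
    blocks : from w₁ w₂ HasBlocks section-blocks w₁ w₂
    blocks = assemble-blocks (section-blocks w₁ w₂)

  from-* : ∀ k w₁ w₂ → from (k • w₁) (k • w₂) ≗ k • from w₁ w₂
  from-* k w₁ w₂ = assemble-cong scale
    where
    scale : ∀ x → section-blocks (k • w₁) (k • w₂) x ≗ k • section-blocks w₁ w₂ x
    scale 0F y = sym (ℤ.*-zeroʳ k)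
    scale 1F y = distrib k (w₁ y) (w₂ y)
      where
      distrib : ∀ k a b → k * a - k * b ≡ k * (a - b)
      distrib = solve-∀
    scale 2F y = refl
    scale 3F y = sym (ℤ.*-zeroʳ k)

  from-image : ∀ {w₁ w₂} → w₁ ∈Im B → w₂ ∈Im A → from w₁ w₂ ∈Im L
  from-image {w₁} {w₂} (s , w₁≗Bs) (t , w₂≗At) =
    assemble lift ,
    ≗-by-blocks (assemble-blocks (section-blocks w₁ w₂))
                (L·ᵥ-blocks {assemble lift} (assemble-blocks lift)) rows
    where
    lift : Fin 4 → ZVec n
    -- Blocks 0, 2, 3 make rows 3 and 2 equal 0 and A t; row 0 then forces block 1.
    lift = A ·ᵥ s ∷ + 3 • A ·ᵥ s -ᵥ + 2 • s -ᵥ t ∷ s +ᵥ t ∷ s ∷ []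
    rows : ∀ x → section-blocks w₁ w₂ x ≗ Lrows lift x
    rows 0F y = balance ((A ·ᵥ s) y) (s y) (t y)
      where
      balance : ∀ b x z → 0ℤ ≡ + 3 * b - (+ 3 * b - + 2 * x - z) - (x + z) - x
      balance = solve-∀
    rows 1F y = begin
      w₁ y - w₂ y
        ≡⟨ cong₂ _-_ (trans (w₁≗Bs y) (B-·ᵥ s y)) (w₂≗At y) ⟩
      + 3 * (a (A ·ᵥ s) - a s) - a t
        ≡⟨ regroup (a (A ·ᵥ s)) (a s) (a t) ⟩
      (+ 3 * a (A ·ᵥ s) - + 2 * a s - a t) - a s
        ≡⟨ cong (_- a s) expand ⟨
      a (+ 3 • A ·ᵥ s -ᵥ + 2 • s -ᵥ t) - a s ∎
      where
      a : ZVec n → ℤ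
      a w = (A ·ᵥ w) y
      regroup : ∀ c b d → + 3 * (c - b) - d ≡ (+ 3 * c - + 2 * b - d) - b
      regroup = solve-∀
      expand : a (+ 3 • A ·ᵥ s -ᵥ + 2 • s -ᵥ t) ≡ + 3 * a (A ·ᵥ s) - + 2 * a s - a t
      expand = begin
        a (+ 3 • A ·ᵥ s -ᵥ + 2 • s -ᵥ t)      ≡⟨ ·ᵥ-− A (+ 3 • A ·ᵥ s -ᵥ + 2 • s) t y ⟩
        a (+ 3 • A ·ᵥ s -ᵥ + 2 • s) - a t     ≡⟨ cong (_- a t) (·ᵥ-− A (+ 3 • A ·ᵥ s) (+ 2 • s) y) ⟩
        a (+ 3 • A ·ᵥ s) - a (+ 2 • s) - a t
          ≡⟨ cong₂ (λ p q → p - q - a t) (·ᵥ-* A (+ 3) (A ·ᵥ s) y) (·ᵥ-* A (+ 2) s y) ⟩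
        + 3 * a (A ·ᵥ s) - + 2 * a s - a t    ∎
    rows 2F y = begin
      w₂ y                                  ≡⟨ w₂≗At y ⟩
      (A ·ᵥ t) y                            ≡⟨ add-sub ((A ·ᵥ s) y) ((A ·ᵥ t) y) ⟩
      (A ·ᵥ s) y + (A ·ᵥ t) y - (A ·ᵥ s) y  ≡⟨ cong (_- (A ·ᵥ s) y) (·ᵥ-+ A s t y) ⟨
      (A ·ᵥ (s +ᵥ t)) y - (A ·ᵥ s) y        ∎
      where
      add-sub : ∀ b c → c ≡ b + c - b
      add-sub = solve-∀
    rows 3F y = sym (ℤ.+-inverseʳ ((A ·ᵥ s) y))

  from-to : ∀ v → v -ᵥ from (to₁ v) (to₂ v) ∈Im L
  from-to v =
    assemble lift ,
    ≗-by-blocks (-ᵥ-blocks {v} {from (to₁ v) (to₂ v)}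
                  (blocks-part v) (assemble-blocks (section-blocks (to₁ v) (to₂ v))))
                (L·ᵥ-blocks {assemble lift} (assemble-blocks lift)) rows
    where
    v₀ v₁ v₂ v₃ : ZVec n
    v₀ = part v 0F
    v₁ = part v 1F
    v₂ = part v 2F
    v₃ = part v 3F
    lift : Fin 4 → ZVec n
    -- Blocks 2 and 3 of the left side both equal v₃, matched by blocks 0, 2, 3 = −v₃, 0, 0;
    -- row 0 then forces block 1.
    lift = - 1ℤ • v₃ ∷ - 1ℤ • (v₀ +ᵥ + 3 • v₃) ∷ 0ᵥ ∷ 0ᵥ ∷ []
    rows : ∀ x → part v x -ᵥ section-blocks (to₁ v) (to₂ v) x ≗ Lrows lift x
    rows 0F y = balance (v₀ y) (v₃ y)
      where
      balance : ∀ x₀ x₃ → x₀ - 0ℤ ≡ + 3 * (- 1ℤ * x₃) - - 1ℤ * (x₀ + + 3 * x₃) - 0ℤ - 0ℤ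
      balance = solve-∀
    rows 1F y = begin
      v₁ y - (to₁ v y - to₂ v y)
        ≡⟨ regroup (a v₀) (v₁ y) (v₂ y) (a v₃) (v₃ y) ⟩
      - 1ℤ * (a v₀ + + 3 * a v₃) - - 1ℤ * v₃ y
        ≡⟨ cong (_- - 1ℤ * v₃ y) expand ⟨
      a (- 1ℤ • (v₀ +ᵥ + 3 • v₃)) - - 1ℤ * v₃ y ∎
      where
      a : ZVec n → ℤ
      a w = (A ·ᵥ w) y
      regroup : ∀ b₀ x₁ x₂ b₃ x₃ →
        x₁ - ((b₀ + x₁ + x₂ + + 3 * b₃ - + 2 * x₃) - (x₂ - x₃)) ≡ - 1ℤ * (b₀ + + 3 * b₃) - - 1ℤ * x₃
      regroup = solve-∀
      expand : a (- 1ℤ • (v₀ +ᵥ + 3 • v₃)) ≡ - 1ℤ * (a v₀ + + 3 * a v₃)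
      expand = begin
        a (- 1ℤ • (v₀ +ᵥ + 3 • v₃))       ≡⟨ ·ᵥ-* A (- 1ℤ) (v₀ +ᵥ + 3 • v₃) y ⟩
        - 1ℤ * a (v₀ +ᵥ + 3 • v₃)         ≡⟨ cong (_*_ (- 1ℤ)) (·ᵥ-+ A v₀ (+ 3 • v₃) y) ⟩
        - 1ℤ * (a v₀ + a (+ 3 • v₃))      ≡⟨ cong (λ z → - 1ℤ * (a v₀ + z)) (·ᵥ-* A (+ 3) v₃ y) ⟩
        - 1ℤ * (a v₀ + + 3 * a v₃)        ∎
    rows 2F y = trans (difference (v₂ y) (v₃ y)) (cong (_- - 1ℤ * v₃ y) (sym (·ᵥ-0ᵥ A y)))
      where
      difference : ∀ x₂ x₃ → x₂ - (x₂ - x₃) ≡ 0ℤ - - 1ℤ * x₃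
      difference = solve-∀
    rows 3F y = trans (difference (v₃ y)) (cong (_- - 1ℤ * v₃ y) (sym (·ᵥ-0ᵥ A y)))
      where
      difference : ∀ x₃ → x₃ - 0ℤ ≡ 0ℤ - - 1ℤ * x₃
      difference = solve-∀

  splitting : CokerSplitting L B A
  splitting = record
    { to₁        = to₁
    ; to₂        = to₂
    ; from       = from
    ; to₁-linear = to₁-linear
    ; to₂-linear = to₂-linear
    ; from-*     = from-*
    ; to₁-image  = to₁-image
    ; to₂-image  = to₂-image
    ; from-image = from-image
    ; to₁-from   = to₁-from
    ; to₂-from   = to₂-from
    ; from-to    = from-to
    }

proposition1 : (m : ℕ) →
    TorsIso (JacY m)
            (coker ((+ 3) ·ₘ ((matA m *ₘ matA m) -ₘ matA m)) ⊕ coker (matA m))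
proposition1 m = splitting⇒TorsIso (Y111.splitting m)
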